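{- Let $p$ be a prime with $p\neq2$ and $p\neq5$. Then $p$ is a Fibonacci–Wieferich prime, i.e. $\pi(p)=\pi(p^2)$, if and only if $\alpha^{p^2-1}\equiv 1 \pmod{p^2\mathbb{Z}[\alpha]}$, i.e. the image of $\alpha^{p^2-1}$ in $\mathbb{Z}[\alpha]/p^2\mathbb{Z}[\alpha]$ is $1$.
   Context: $\{F_n\}$ is the Fibonacci sequence with $F_0=0$, $F_1=1$, $F_n=F_{n-1}+F_{n-2}$ for $n\ge2$. For a positive integer $m$, $\pi(m)$ denotes the period of the sequence $\{F_n \bmod m\}$. Here $\alpha=(1+\sqrt5)/2$ and $\mathbb{Z}[\alpha]$ is the ring of integers of $\mathbb{Q}(\sqrt5)$. -}

module Defs where

open import Data.Nat as ℕ using (ℕ; zero; suc; _+_; _<_)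
open import Data.Integer as ℤ using (ℤ; +_)
open import Data.Integer.Divisibility using (_∣_)
open import Data.Product using (_×_; _,_)

fib : ℕ → ℕ
fib zero = zero
fib (suc zero) = 1
fib (suc (suc n)) = fib (suc n) + fib n

_≡_[mod_] : ℤ → ℤ → ℕ → Set
a ≡ b [mod m ] = (+ m) ∣ (a ℤ.- b)

IsFibPeriod : ℕ → ℕ → Set
IsFibPeriod m k = ∀ n → (+ fib (n + k)) ≡ (+ fib n) [mod m ]

IsPisanoPeriod : ℕ → ℕ → Set
IsPisanoPeriod m k =
  (0 < k) × IsFibPeriod m k × (∀ j → 0 < j → IsFibPeriod m j → k ℕ.≤ j)

-- Z[α], α = (1+√5)/2, α² = α + 1; the pair (a , b) represents a + bα
ZAlpha : Set
ZAlpha = ℤ × ℤ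

oneα : ZAlpha
oneα = (+ 1 , + 0)

α : ZAlpha
α = (+ 0 , + 1)

-- (a + bα)(c + dα) = (ac + bd) + (ad + bc + bd)α
_*α_ : ZAlpha → ZAlpha → ZAlpha
(a , b) *α (c , d) = (a ℤ.* c ℤ.+ b ℤ.* d , a ℤ.* d ℤ.+ b ℤ.* c ℤ.+ b ℤ.* d)

_^α_ : ZAlpha → ℕ → ZAlpha
x ^α zero = oneα
x ^α suc n = x *α (x ^α n)

-- x ≡ y (mod m Z[α]) : since {1, α} is a Z-basis of Z[α], m Z[α] consists
-- of the elements whose both coordinates are divisible by m
_≡α_[mod_] : ZAlpha → ZAlpha → ℕ → Set
(a , b) ≡α (c , d) [mod m ] = (a ≡ c [mod m ]) × (b ≡ d [mod m ])

{-# OPTIONS --safe #-}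

-- Fₙ is the α-coordinate of αⁿ in ℤ[α], so the periods of (Fₙ mod m) are exactly the k with
-- αᵏ ≡ 1 (mod m), and π(m) is the order of α modulo m. Modulo p the binomial theorem makes
-- x ↦ xᵖ additive and the identity on ℤ/p (Fermat), and √5 = 2α − 1 satisfies
-- √5^(p²) = 5^((p²−1)/2) √5 = √5; hence (2α)^(p²) = 2α, that is α^(p²−1) ≡ 1 (mod p).
-- If π(p) = π(p²), this period carries over to p². Conversely, writing αᴷ = 1 + p y for
-- K = π(p) gives α^(Kp) ≡ 1 (mod p²), so π(p²) divides both Kp and p² − 1, hence divides K;
-- and K divides π(p²) because reduction mod p preserves periods.

module Submission where

open import Defs
open import Algebra.Bundles using (CommutativeRing; CommutativeSemiring; Semiring)
open import Algebra.Structures using (IsCommutativeRing)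
open import Data.Empty using (⊥-elim)
open import Data.Fin as Fin using (Fin; toℕ)
import Data.Fin.Properties as Fin
open import Data.Integer as ℤ using (ℤ; +_)
import Data.Integer.Properties as ℤ
open import Data.Integer.Divisibility.Signed as ℤ∣ using (divides)
open import Data.Integer.Tactic.RingSolver using (solve-∀)
open import Data.Nat as ℕ using (ℕ; zero; suc; _∸_; _<_; _≤_; z≤n; s≤s; _!)
import Data.Nat.Properties as ℕ
open import Data.Nat.Combinatorics using (_C_; nCk≡n!/k![n-k]!; k![n∸k]!∣n!; nCn≡1)
open import Data.Nat.Divisibility as ℕ∣ using (_∣_; divides)
open import Data.Nat.DivMod using (_%_; _/_; m≡m%n+[m/n]*n; m%n<n; m/n*n≡m)
open import Data.Nat.Induction using (<-rec)
open import Data.Nat.Primality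
  using (Prime; ¬prime[1]; prime[2]; prime?; euclidsLemma; prime⇒irreducible; prime⇒nonZero; prime⇒nonTrivial)
import Data.Nat.Tactic.RingSolver as ℕ-Solver
open import Data.Product using (_×_; _,_; proj₁; proj₂; ∃)
open import Data.Sum using (inj₁; inj₂)
open import Data.Vec.Functional using (tail; init; last)
open import Function.Base using (_∘_)
open import Function.Bundles using (_⇔_; mk⇔; Equivalence)
open import Function.Properties.Equivalence using () renaming (sym to ⇔-sym)
open import Level using (0ℓ)
open import Relation.Binary.PropositionalEquality as ≡ using (_≡_; _≢_; refl; cong; cong₂; subst)
open import Relation.Binary.Structures using (IsEquivalence)
open import Relation.Nullary using (¬_; Dec; yes; no)
import Relation.Nullary.Decidable as Dec

infix 4 _≋_[mod_]

-- Unlike _≡_[mod_] of Defs, which unfolds to divisibility of absolute values, a record keeps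
-- a and b visible to unification.
record _≋_[mod_] (a b : ℤ) (m : ℕ) : Set where
  constructor mod-divides
  field
    diff-divisible : + m ℤ∣.∣ a ℤ.- b

open _≋_[mod_]

module _ {m : ℕ} where

  ≋-by : ∀ {a b c} → a ℤ.- b ≡ c → + m ℤ∣.∣ c → a ≋ b [mod m ]
  ≋-by eq m∣c = mod-divides (subst (+ m ℤ∣.∣_) (≡.sym eq) m∣c)

  ≋-refl : ∀ {a} → a ≋ a [mod m ]
  ≋-refl {a} = ≋-by (ℤ.+-inverseʳ a) (divides (+ 0) (≡.sym (ℤ.*-zeroˡ (+ m))))

  ≋-sym : ∀ {a b} → a ≋ b [mod m ] → b ≋ a [mod m ]
  ≋-sym {a} {b} (mod-divides d) = ≋-by (lemma a b) (ℤ∣.∣m⇒∣-m d)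
    where lemma : ∀ a b → b ℤ.- a ≡ ℤ.- (a ℤ.- b)
          lemma = solve-∀

  ≋-trans : ∀ {a b c} → a ≋ b [mod m ] → b ≋ c [mod m ] → a ≋ c [mod m ]
  ≋-trans {a} {b} {c} (mod-divides d) (mod-divides e) = ≋-by (lemma a b c) (ℤ∣.∣m∣n⇒∣m+n d e)
    where lemma : ∀ a b c → a ℤ.- c ≡ (a ℤ.- b) ℤ.+ (b ℤ.- c)
          lemma = solve-∀

  +-cong-≋ : ∀ {a b c d} → a ≋ b [mod m ] → c ≋ d [mod m ] → a ℤ.+ c ≋ b ℤ.+ d [mod m ]
  +-cong-≋ {a} {b} {c} {d} (mod-divides e) (mod-divides f) =
    ≋-by (lemma a b c d) (ℤ∣.∣m∣n⇒∣m+n e f)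
    where lemma : ∀ a b c d → (a ℤ.+ c) ℤ.- (b ℤ.+ d) ≡ (a ℤ.- b) ℤ.+ (c ℤ.- d)
          lemma = solve-∀

  neg-cong-≋ : ∀ {a b} → a ≋ b [mod m ] → ℤ.- a ≋ ℤ.- b [mod m ]
  neg-cong-≋ {a} {b} (mod-divides d) = ≋-by (lemma a b) (ℤ∣.∣m⇒∣-m d)
    where lemma : ∀ a b → ℤ.- a ℤ.- ℤ.- b ≡ ℤ.- (a ℤ.- b)
          lemma = solve-∀

  *-cong-≋ : ∀ {a b c d} → a ≋ b [mod m ] → c ≋ d [mod m ] → a ℤ.* c ≋ b ℤ.* d [mod m ]
  *-cong-≋ {a} {b} {c} {d} (mod-divides e) (mod-divides f) =
    ≋-by (lemma a b c d) (ℤ∣.∣m∣n⇒∣m+n (ℤ∣.∣m⇒∣m*n c e) (ℤ∣.∣n⇒∣m*n b f))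
    where lemma : ∀ a b c d → a ℤ.* c ℤ.- b ℤ.* d ≡ (a ℤ.- b) ℤ.* c ℤ.+ b ℤ.* (c ℤ.- d)
          lemma = solve-∀

  ≋-dec : ∀ a b → Dec (a ≋ b [mod m ])
  ≋-dec a b = Dec.map′ mod-divides diff-divisible (+ m ℤ∣.∣? (a ℤ.- b))

  ≋⇒≡[mod] : ∀ {a b} → a ≋ b [mod m ] → a ≡ b [mod m ]
  ≋⇒≡[mod] (mod-divides d) = ℤ∣.∣⇒∣ᵤ d

  ≡[mod]⇒≋ : ∀ {a b} → a ≡ b [mod m ] → a ≋ b [mod m ]
  ≡[mod]⇒≋ d = mod-divides (ℤ∣.∣ᵤ⇒∣ d)

≋-mod-*ʳ : ∀ {a b m n} → a ≋ b [mod m ℕ.* n ] → a ≋ b [mod m ]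
≋-mod-*ʳ {m = m} {n} (mod-divides d) =
  mod-divides (ℤ∣.∣-trans (divides (+ n) (≡.trans (ℤ.pos-* m n) (ℤ.*-comm (+ m) (+ n)))) d)

≋-cancel-*ˡ : ∀ {p c a b} → Prime p → ¬ p ∣ c → + c ℤ.* a ≋ + c ℤ.* b [mod p ] → a ≋ b [mod p ]
≋-cancel-*ˡ {p} {c} {a} {b} p-prime p∤c (mod-divides p∣ca-cb)
  with euclidsLemma c ℤ.∣ a ℤ.- b ∣ p-prime
         (subst (p ∣_) (ℤ.abs-* (+ c) (a ℤ.- b))
           (ℤ∣.∣⇒∣ᵤ (subst (+ p ℤ∣.∣_) (distrib (+ c) a b) p∣ca-cb)))
  where
  distrib : ∀ c a b → c ℤ.* a ℤ.- c ℤ.* b ≡ c ℤ.* (a ℤ.- b)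
  distrib = solve-∀
... | inj₁ p∣c     = ⊥-elim (p∤c p∣c)
... | inj₂ p∣∣a-b∣ = mod-divides (ℤ∣.∣ᵤ⇒∣ p∣∣a-b∣)

-- The ring ℤ[α] / m

infix 4 _≈α_[mod_]

record _≈α_[mod_] (x y : ZAlpha) (m : ℕ) : Set where
  constructor _,_
  field
    coeff₀ : proj₁ x ≋ proj₁ y [mod m ]
    coeff₁ : proj₂ x ≋ proj₂ y [mod m ]

_+α_ : ZAlpha → ZAlpha → ZAlpha
(a , b) +α (c , d) = (a ℤ.+ c , b ℤ.+ d)

-α_ : ZAlpha → ZAlpha
-α (a , b) = (ℤ.- a , ℤ.- b)

zeroα : ZAlpha
zeroα = (+ 0 , + 0)

α⁻¹ : ZAlpha
α⁻¹ = (ℤ.- + 1 , + 1)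

≈α⇒≡α : ∀ {x y m} → x ≈α y [mod m ] → x ≡α y [mod m ]
≈α⇒≡α {_ , _} {_ , _} (p , q) = ≋⇒≡[mod] p , ≋⇒≡[mod] q

≡α⇒≈α : ∀ {x y m} → x ≡α y [mod m ] → x ≈α y [mod m ]
≡α⇒≈α {_ , _} {_ , _} (p , q) = ≡[mod]⇒≋ p , ≡[mod]⇒≋ q

≈α-mod-*ʳ : ∀ {x y m n} → x ≈α y [mod m ℕ.* n ] → x ≈α y [mod m ]
≈α-mod-*ʳ (p , q) = ≋-mod-*ʳ p , ≋-mod-*ʳ q

module _ (m : ℕ) where

  private
    _≈_ : ZAlpha → ZAlpha → Set
    x ≈ y = x ≈α y [mod m ]

  ≈α-reflexive : ∀ {x y} → x ≡ y → x ≈ y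
  ≈α-reflexive refl = ≋-refl , ≋-refl

  ≈α-isEquivalence : IsEquivalence _≈_
  ≈α-isEquivalence = record
    { refl  = ≈α-reflexive refl
    ; sym   = λ (p , q) → ≋-sym p , ≋-sym q
    ; trans = λ (p , q) (p′ , q′) → ≋-trans p p′ , ≋-trans q q′
    }

  private
    exactly : ∀ {a b c d} → a ≡ c → b ≡ d → (a , b) ≈ (c , d)
    exactly refl refl = ≈α-reflexive refl

  +α-cong : ∀ {x y u v} → x ≈ y → u ≈ v → (x +α u) ≈ (y +α v)
  +α-cong {_ , _} {_ , _} {_ , _} {_ , _} (p , q) (p′ , q′) = +-cong-≋ p p′ , +-cong-≋ q q′

  *α-cong : ∀ {x y u v} → x ≈ y → u ≈ v → (x *α u) ≈ (y *α v)
  *α-cong {_ , _} {_ , _} {_ , _} {_ , _} (p , q) (p′ , q′) =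
    +-cong-≋ (*-cong-≋ p p′) (*-cong-≋ q q′) ,
    +-cong-≋ (+-cong-≋ (*-cong-≋ p q′) (*-cong-≋ q p′)) (*-cong-≋ q q′)

  -α-cong : ∀ {x y} → x ≈ y → (-α x) ≈ (-α y)
  -α-cong {_ , _} {_ , _} (p , q) = neg-cong-≋ p , neg-cong-≋ q

  *α-assoc : ∀ x y z → ((x *α y) *α z) ≈ (x *α (y *α z))
  *α-assoc (a , b) (c , d) (e , f) = exactly (lemma₀ a b c d e f) (lemma₁ a b c d e f)
    where
    lemma₀ : ∀ a b c d e f →
      (a ℤ.* c ℤ.+ b ℤ.* d) ℤ.* e ℤ.+ (a ℤ.* d ℤ.+ b ℤ.* c ℤ.+ b ℤ.* d) ℤ.* f ≡
      a ℤ.* (c ℤ.* e ℤ.+ d ℤ.* f) ℤ.+ b ℤ.* (c ℤ.* f ℤ.+ d ℤ.* e ℤ.+ d ℤ.* f)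
    lemma₀ = solve-∀
    lemma₁ : ∀ a b c d e f →
      (a ℤ.* c ℤ.+ b ℤ.* d) ℤ.* f ℤ.+ (a ℤ.* d ℤ.+ b ℤ.* c ℤ.+ b ℤ.* d) ℤ.* e
        ℤ.+ (a ℤ.* d ℤ.+ b ℤ.* c ℤ.+ b ℤ.* d) ℤ.* f ≡
      a ℤ.* (c ℤ.* f ℤ.+ d ℤ.* e ℤ.+ d ℤ.* f) ℤ.+ b ℤ.* (c ℤ.* e ℤ.+ d ℤ.* f)
        ℤ.+ b ℤ.* (c ℤ.* f ℤ.+ d ℤ.* e ℤ.+ d ℤ.* f)
    lemma₁ = solve-∀

  *α-comm : ∀ x y → (x *α y) ≈ (y *α x)
  *α-comm (a , b) (c , d) = exactly (lemma₀ a b c d) (lemma₁ a b c d)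
    where
    lemma₀ : ∀ a b c d → a ℤ.* c ℤ.+ b ℤ.* d ≡ c ℤ.* a ℤ.+ d ℤ.* b
    lemma₀ = solve-∀
    lemma₁ : ∀ a b c d → a ℤ.* d ℤ.+ b ℤ.* c ℤ.+ b ℤ.* d ≡ c ℤ.* b ℤ.+ d ℤ.* a ℤ.+ d ℤ.* b
    lemma₁ = solve-∀

  *α-identityˡ : ∀ x → (oneα *α x) ≈ x
  *α-identityˡ (a , b) = exactly (lemma₀ a b) (lemma₁ a b)
    where
    lemma₀ : ∀ a b → + 1 ℤ.* a ℤ.+ + 0 ℤ.* b ≡ a
    lemma₀ = solve-∀
    lemma₁ : ∀ a b → + 1 ℤ.* b ℤ.+ + 0 ℤ.* a ℤ.+ + 0 ℤ.* b ≡ b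
    lemma₁ = solve-∀

  *α-identityʳ : ∀ x → (x *α oneα) ≈ x
  *α-identityʳ x = IsEquivalence.trans ≈α-isEquivalence (*α-comm x oneα) (*α-identityˡ x)

  *α-distribˡ-+α : ∀ x y z → (x *α (y +α z)) ≈ ((x *α y) +α (x *α z))
  *α-distribˡ-+α (a , b) (c , d) (e , f) = exactly (lemma₀ a b c d e f) (lemma₁ a b c d e f)
    where
    lemma₀ : ∀ a b c d e f →
      a ℤ.* (c ℤ.+ e) ℤ.+ b ℤ.* (d ℤ.+ f) ≡ (a ℤ.* c ℤ.+ b ℤ.* d) ℤ.+ (a ℤ.* e ℤ.+ b ℤ.* f)
    lemma₀ = solve-∀
    lemma₁ : ∀ a b c d e f →
      a ℤ.* (d ℤ.+ f) ℤ.+ b ℤ.* (c ℤ.+ e) ℤ.+ b ℤ.* (d ℤ.+ f) ≡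
      (a ℤ.* d ℤ.+ b ℤ.* c ℤ.+ b ℤ.* d) ℤ.+ (a ℤ.* f ℤ.+ b ℤ.* e ℤ.+ b ℤ.* f)
    lemma₁ = solve-∀

  *α-distribʳ-+α : ∀ x y z → ((y +α z) *α x) ≈ ((y *α x) +α (z *α x))
  *α-distribʳ-+α x y z =
    trans (*α-comm (y +α z) x)
      (trans (*α-distribˡ-+α x y z)
        (+α-cong {x *α y} {y *α x} {x *α z} {z *α x} (*α-comm x y) (*α-comm x z)))
    where open IsEquivalence ≈α-isEquivalence

  ℤ[α]-isCommutativeRing : IsCommutativeRing _≈_ _+α_ _*α_ -α_ zeroα oneα
  ℤ[α]-isCommutativeRing = record
    { isRing = record
      { +-isAbelianGroup = record
        { isGroup = record
          { isMonoid = record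
            { isSemigroup = record
              { isMagma = record
                { isEquivalence = ≈α-isEquivalence
                ; ∙-cong = λ {x} {y} {u} {v} → +α-cong {x} {y} {u} {v}
                }
              ; assoc = λ { (a , b) (c , d) (e , f) → exactly (ℤ.+-assoc a c e) (ℤ.+-assoc b d f) }
              }
            ; identity = (λ { (a , b) → exactly (ℤ.+-identityˡ a) (ℤ.+-identityˡ b) })
                       , (λ { (a , b) → exactly (ℤ.+-identityʳ a) (ℤ.+-identityʳ b) })
            }
          ; inverse = (λ { (a , b) → exactly (ℤ.+-inverseˡ a) (ℤ.+-inverseˡ b) })
                    , (λ { (a , b) → exactly (ℤ.+-inverseʳ a) (ℤ.+-inverseʳ b) })
          ; ⁻¹-cong = λ {x} {y} → -α-cong {x} {y}
          }
        ; comm = λ { (a , b) (c , d) → exactly (ℤ.+-comm a c) (ℤ.+-comm b d) }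
        }
      ; *-cong = λ {x} {y} {u} {v} → *α-cong {x} {y} {u} {v}
      ; *-assoc = *α-assoc
      ; *-identity = *α-identityˡ , *α-identityʳ
      ; distrib = *α-distribˡ-+α , *α-distribʳ-+α
      }
    ; *-comm = *α-comm
    }

ℤ[α]/_ : ℕ → CommutativeRing 0ℓ 0ℓ
ℤ[α]/ m = record { isCommutativeRing = ℤ[α]-isCommutativeRing m }

IsLeastPositive : ∀ {ℓ} → (ℕ → Set ℓ) → ℕ → Set ℓ
IsLeastPositive P k = 0 < k × P k × (∀ j → 0 < j → P j → k ≤ j)

leastPositive-cong : ∀ {ℓ ℓ′} {P : ℕ → Set ℓ} {Q : ℕ → Set ℓ′} →
  (∀ k → P k ⇔ Q k) → ∀ k → IsLeastPositive P k ⇔ IsLeastPositive Q k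
leastPositive-cong {P = P} {Q} P⇔Q k = mk⇔ (transport P⇔Q) (transport (λ j → ⇔-sym (P⇔Q j)))
  where
  transport : ∀ {ℓ ℓ′} {A : ℕ → Set ℓ} {B : ℕ → Set ℓ′} →
    (∀ j → A j ⇔ B j) → IsLeastPositive A k → IsLeastPositive B k
  transport A⇔B (k>0 , Ak , least) =
    k>0 , Equivalence.to (A⇔B k) Ak , λ j j>0 Bj → least j j>0 (Equivalence.from (A⇔B j) Bj)

leastPositive-exists : ∀ {ℓ} {P : ℕ → Set ℓ} → (∀ k → Dec (P k)) →
  ∀ {j} → 0 < j → P j → ∃ (IsLeastPositive P)
leastPositive-exists {P = P} P? {j} = <-rec Goal search j
  where
  Goal : ℕ → Set _
  Goal j = 0 < j → P j → ∃ (IsLeastPositive P)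
  search : ∀ j → (∀ {i} → i < j → Goal i) → Goal j
  search j rec j>0 Pj with Fin.any? (λ (i : Fin j) → (0 ℕ.<? toℕ i) Dec.×-dec P? (toℕ i))
  ... | yes (i , i>0 , Pi) = rec (Fin.toℕ<n i) i>0 Pi
  ... | no none = j , j>0 , Pj , λ i i>0 Pi → ℕ.≮⇒≥ λ i<j →
          none (Fin.fromℕ< i<j ,
                subst (λ n → 0 < n × P n) (≡.sym (Fin.toℕ-fromℕ< i<j)) (i>0 , Pi))

module Periods {a ℓ} (S : Semiring a ℓ) where

  open Semiring S renaming (refl to ≈-refl)
  open import Algebra.Properties.Semiring.Exp S
  open import Relation.Binary.Reasoning.Setoid setoid

  IsPeriodOf : Carrier → ℕ → Set ℓ
  IsPeriodOf x k = x ^ k ≈ 1#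

  1#^n≈1# : ∀ n → 1# ^ n ≈ 1#
  1#^n≈1# zero    = ≈-refl
  1#^n≈1# (suc n) = trans (*-identityˡ _) (1#^n≈1# n)

  module _ {x : Carrier} where

    period-*ˡ : ∀ {k} → IsPeriodOf x k → ∀ q → IsPeriodOf x (q ℕ.* k)
    period-*ˡ {k} xᵏ≈1 q = begin
      x ^ (q ℕ.* k)   ≡⟨ cong (x ^_) (ℕ.*-comm q k) ⟩
      x ^ (k ℕ.* q)   ≈⟨ ^-assocʳ x k q ⟨
      (x ^ k) ^ q   ≈⟨ ^-congˡ q xᵏ≈1 ⟩
      1# ^ q        ≈⟨ 1#^n≈1# q ⟩
      1#            ∎

    period-∸ : ∀ {r j} → IsPeriodOf x (r ℕ.+ j) → IsPeriodOf x j → IsPeriodOf x r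
    period-∸ {r} {j} xʳ⁺ʲ≈1 xʲ≈1 = begin
      x ^ r           ≈⟨ *-identityʳ (x ^ r) ⟨
      x ^ r * 1#      ≈⟨ *-congˡ xʲ≈1 ⟨
      x ^ r * x ^ j   ≈⟨ ^-homo-* x r j ⟨
      x ^ (r ℕ.+ j)   ≈⟨ xʳ⁺ʲ≈1 ⟩
      1#              ∎

    leastPeriod-∣ : ∀ {K j} → IsLeastPositive (IsPeriodOf x) K → IsPeriodOf x j → K ∣ j
    leastPeriod-∣ {K@(suc _)} {j} (_ , xᴷ≈1 , least) xʲ≈1 with j % K ℕ.≟ 0
    ... | yes r≡0 =
      divides (j / K) (≡.trans (m≡m%n+[m/n]*n j K) (cong (λ r → r ℕ.+ (j / K) ℕ.* K) r≡0))
    ... | no r≢0 =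
      ⊥-elim (ℕ.<⇒≱ (m%n<n j K) (least (j % K) (ℕ.n≢0⇒n>0 r≢0) remainder-period))
      where
      remainder-period : IsPeriodOf x (j % K)
      remainder-period = period-∸ {j % K} {(j / K) ℕ.* K}
        (subst (IsPeriodOf x) (m≡m%n+[m/n]*n j K) xʲ≈1) (period-*ˡ xᴷ≈1 (j / K))

    period-∣ : ∀ {k j} → IsPeriodOf x k → k ∣ j → IsPeriodOf x j
    period-∣ xᵏ≈1 (divides q refl) = period-*ˡ xᵏ≈1 q

    period-by-inverse : ∀ {u k} → u * x ≈ 1# → x ^ suc k ≈ x → IsPeriodOf x k
    period-by-inverse {u} {k} ux≈1 xᵏ⁺¹≈x = begin
      x ^ k              ≈⟨ *-identityˡ (x ^ k) ⟨
      1# * x ^ k         ≈⟨ *-congʳ ux≈1 ⟨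
      (u * x) * x ^ k    ≈⟨ *-assoc u x (x ^ k) ⟩
      u * x ^ suc k      ≈⟨ *-congˡ xᵏ⁺¹≈x ⟩
      u * x              ≈⟨ ux≈1 ⟩
      1#                 ∎

-- The Frobenius map in characteristic p

prime∤! : ∀ {p} → Prime p → ∀ n → n < p → ¬ p ∣ n !
prime∤! p-prime zero    _   p∣1 = ¬prime[1] (subst Prime (ℕ∣.∣1⇒≡1 p∣1) p-prime)
prime∤! p-prime (suc n) n<p p∣n! with euclidsLemma (suc n) (n !) p-prime p∣n!
... | inj₁ p∣n+1 = ℕ.<⇒≱ n<p (ℕ∣.∣⇒≤ p∣n+1)
... | inj₂ p∣n!′ = prime∤! p-prime n (ℕ.<-trans (ℕ.n<1+n n) n<p) p∣n!′

prime∤prime : ∀ {p q} → Prime p → Prime q → p ≢ q → ¬ p ∣ q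
prime∤prime p-prime q-prime p≢q p∣q with prime⇒irreducible q-prime p∣q
... | inj₁ p≡1 = ¬prime[1] (subst Prime p≡1 p-prime)
... | inj₂ p≡q = p≢q p≡q

odd-prime : ∀ {p} → Prime p → p ≢ 2 → ∃ λ h → p ≡ suc (2 ℕ.* h)
odd-prime {p} p-prime p≢2 with p % 2 | m%n<n p 2 | m≡m%n+[m/n]*n p 2
... | 0 | _ | p≡[p/2]*2 =
  ⊥-elim (prime∤prime prime[2] p-prime (p≢2 ∘ ≡.sym) (divides (p / 2) p≡[p/2]*2))
... | 1 | _ | p≡1+[p/2]*2 = p / 2 , ≡.trans p≡1+[p/2]*2 (cong suc (ℕ.*-comm (p / 2) 2))
... | suc (suc _) | s≤s (s≤s ()) | _

nCk*[k!*[n∸k]!]≡n! : ∀ {n k} → k ≤ n → (n C k) ℕ.* (k ! ℕ.* (n ∸ k) !) ≡ n !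
nCk*[k!*[n∸k]!]≡n! {n} {k} k≤n =
  ≡.trans (cong (ℕ._* (k ! ℕ.* (n ∸ k) !)) (nCk≡n!/k![n-k]! k≤n))
          (m/n*n≡m {{ℕ._!*_!≢0 k (n ∸ k)}} (k![n∸k]!∣n! k≤n))

prime∣pCk : ∀ {p k} → Prime p → 0 < k → k < p → p ∣ p C k
prime∣pCk {p@(suc q)} {k} p-prime k>0 k<p
  with euclidsLemma (p C k) (k ! ℕ.* (p ∸ k) !) p-prime
         (subst (p ∣_) (≡.sym (nCk*[k!*[n∸k]!]≡n! (ℕ.<⇒≤ k<p))) (ℕ∣.m∣m*n (q !)))
... | inj₁ p∣pCk = p∣pCk
... | inj₂ p∣k![p∸k]! with euclidsLemma (k !) ((p ∸ k) !) p-prime p∣k![p∸k]!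
...   | inj₁ p∣k!     = ⊥-elim (prime∤! p-prime k k<p p∣k!)
...   | inj₂ p∣[p∸k]! =
  ⊥-elim (prime∤! p-prime (p ∸ k) (ℕ.∸-monoʳ-< k>0 (ℕ.<⇒≤ k<p)) p∣[p∸k]!)

module Frobenius {a ℓ} (R : CommutativeSemiring a ℓ) where

  open CommutativeSemiring R
  open import Algebra.Properties.Semiring.Exp semiring
  open import Algebra.Properties.Semiring.Mult semiring renaming (_×_ to _·_)
  open import Algebra.Properties.Semiring.Sum semiring
    using (sum; sum-cong-≋; sum-init-last; sum-replicate-zero)
  open import Algebra.Properties.CommutativeSemiring.Binomial R using (theorem; binomialTerm)
  open import Relation.Binary.Reasoning.Setoid setoid
  open Periods semiring using (1#^n≈1#)

  0#^n≈0# : ∀ n .{{_ : ℕ.NonZero n}} → 0# ^ n ≈ 0#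
  0#^n≈0# (suc n) = zeroˡ (0# ^ n)

  freshmansDream : ∀ n .{{_ : ℕ.NonZero n}} → (∀ k → 0 < k → k < n → ∀ z → (n C k) · z ≈ 0#) →
                   ∀ x y → (x + y) ^ n ≈ x ^ n + y ^ n
  freshmansDream (suc n) inner≈0 x y = begin
    (x + y) ^ suc n                                  ≈⟨ theorem (suc n) x y ⟩
    t Fin.zero + sum (tail t)                        ≈⟨ +-congˡ (sum-init-last (tail t)) ⟩
    t Fin.zero + (sum (init (tail t)) + last (tail t)) ≈⟨ +-congˡ (+-congʳ inner-sum≈0) ⟩
    t Fin.zero + (0# + last (tail t))                ≈⟨ +-cong first≈yⁿ (trans (+-identityˡ _) last≈xⁿ) ⟩
    y ^ suc n + x ^ suc n                            ≈⟨ +-comm (y ^ suc n) (x ^ suc n) ⟩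
    x ^ suc n + y ^ suc n                            ∎
    where
    t = binomialTerm x y (suc n)
    first≈yⁿ : t Fin.zero ≈ y ^ suc n
    first≈yⁿ = trans (×-homo-1 _) (*-identityˡ _)
    last≈xⁿ : last (tail t) ≈ x ^ suc n
    last≈xⁿ rewrite Fin.toℕ-fromℕ n | nCn≡1 (suc n) | ℕ.n∸n≡0 n =
      trans (×-homo-1 _) (*-identityʳ _)
    inner-sum≈0 : sum (init (tail t)) ≈ 0#
    inner-sum≈0 =
      trans (sum-cong-≋ λ i → inner≈0 _ (s≤s z≤n) (s≤s (inner-index<n i)) _) (sum-replicate-zero n)
      where
      inner-index<n : ∀ (i : Fin n) → toℕ (Fin.inject₁ i) < n
      inner-index<n i = subst (_< n) (≡.sym (Fin.toℕ-inject₁ i)) (Fin.toℕ<n i)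

  p∣n⇒n·z≈0# : ∀ {p} → p · 1# ≈ 0# → ∀ {n} → p ∣ n → ∀ z → n · z ≈ 0#
  p∣n⇒n·z≈0# {p} char-p (divides q refl) z = begin
    (q ℕ.* p) · z               ≈⟨ ×-congʳ (q ℕ.* p) (*-identityˡ z) ⟨
    (q ℕ.* p) · (1# * z)        ≈⟨ ×-assoc-* (q ℕ.* p) 1# z ⟨
    ((q ℕ.* p) · 1#) * z        ≈⟨ *-congʳ (×1-homo-* q p) ⟩
    ((q · 1#) * (p · 1#)) * z   ≈⟨ *-congʳ (*-congˡ char-p) ⟩
    ((q · 1#) * 0#) * z         ≈⟨ *-congʳ (zeroʳ (q · 1#)) ⟩
    0# * z                      ≈⟨ zeroˡ z ⟩
    0#                          ∎

  module _ {p} (p-prime : Prime p) (char-p : p · 1# ≈ 0#) where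

    private instance
      p≢0 : ℕ.NonZero p
      p≢0 = prime⇒nonZero p-prime

    ^p-distrib-+ : ∀ x y → (x + y) ^ p ≈ x ^ p + y ^ p
    ^p-distrib-+ = freshmansDream p λ k k>0 k<p → p∣n⇒n·z≈0# char-p (prime∣pCk p-prime k>0 k<p)

    fermatsLittleTheorem : ∀ n → (n · 1#) ^ p ≈ n · 1#
    fermatsLittleTheorem zero = 0#^n≈0# p
    fermatsLittleTheorem (suc n) = begin
      (1# + n · 1#) ^ p      ≈⟨ ^p-distrib-+ 1# (n · 1#) ⟩
      1# ^ p + (n · 1#) ^ p  ≈⟨ +-cong (1#^n≈1# p) (fermatsLittleTheorem n) ⟩
      1# + n · 1#            ∎

    ^p²-distrib-+ : ∀ x y → (x + y) ^ (p ℕ.* p) ≈ x ^ (p ℕ.* p) + y ^ (p ℕ.* p)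
    ^p²-distrib-+ x y = begin
      (x + y) ^ (p ℕ.* p)          ≈⟨ ^-assocʳ (x + y) p p ⟨
      ((x + y) ^ p) ^ p            ≈⟨ ^-congˡ p (^p-distrib-+ x y) ⟩
      (x ^ p + y ^ p) ^ p          ≈⟨ ^p-distrib-+ (x ^ p) (y ^ p) ⟩
      (x ^ p) ^ p + (y ^ p) ^ p    ≈⟨ +-cong (^-assocʳ x p p) (^-assocʳ y p p) ⟩
      x ^ (p ℕ.* p) + y ^ (p ℕ.* p) ∎

    fermatsLittleTheorem² : ∀ n → (n · 1#) ^ (p ℕ.* p) ≈ n · 1#
    fermatsLittleTheorem² n = begin
      (n · 1#) ^ (p ℕ.* p)   ≈⟨ ^-assocʳ (n · 1#) p p ⟨
      ((n · 1#) ^ p) ^ p     ≈⟨ ^-congˡ p (fermatsLittleTheorem n) ⟩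
      (n · 1#) ^ p           ≈⟨ fermatsLittleTheorem n ⟩
      n · 1#                 ∎

module ℤ[α]-mod (m : ℕ) where

  open CommutativeRing (ℤ[α]/ m) public renaming (refl to ≈-refl)
  open import Algebra.Properties.Semiring.Exp semiring public
  open import Algebra.Properties.Semiring.Mult semiring public using () renaming (_×_ to _·_)
  open Periods semiring public

  ^≡^α : ∀ x n → x ^ n ≡ x ^α n
  ^≡^α x zero    = refl
  ^≡^α x (suc n) = cong (x *α_) (^≡^α x n)

  n·1#≈n : ∀ n → n · 1# ≈ (+ n , + 0)
  n·1#≈n zero    = ≈α-reflexive m refl
  n·1#≈n (suc n) = +-congˡ {1#} (n·1#≈n n)

  infix 4 _≟_
  _≟_ : ∀ x y → Dec (x ≈ y)
  (a , b) ≟ (c , d) =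
    Dec.map′ (λ (p , q) → p , q) (λ (p , q) → p , q) (≋-dec a c Dec.×-dec ≋-dec b d)

IsAlphaPeriod : ℕ → ℕ → Set
IsAlphaPeriod m = ℤ[α]-mod.IsPeriodOf m α

α^[1+n]≡[Fₙ,Fₙ₊₁] : ∀ n → α ^α suc n ≡ (+ fib n , + fib (suc n))
α^[1+n]≡[Fₙ,Fₙ₊₁] zero    = refl
α^[1+n]≡[Fₙ,Fₙ₊₁] (suc n) =
  ≡.trans (cong (α *α_) (α^[1+n]≡[Fₙ,Fₙ₊₁] n))
          (cong₂ _,_ (lemma₀ (+ fib n) (+ fib (suc n))) (lemma₁ (+ fib n) (+ fib (suc n))))
  where
  lemma₀ : ∀ a b → + 0 ℤ.* a ℤ.+ + 1 ℤ.* b ≡ b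
  lemma₀ = solve-∀
  lemma₁ : ∀ a b → + 0 ℤ.* b ℤ.+ + 1 ℤ.* a ℤ.+ + 1 ℤ.* b ≡ b ℤ.+ a
  lemma₁ = solve-∀

coeff₁-α^n≡Fₙ : ∀ n → proj₂ (α ^α n) ≡ + fib n
coeff₁-α^n≡Fₙ zero    = refl
coeff₁-α^n≡Fₙ (suc n) = cong proj₂ (α^[1+n]≡[Fₙ,Fₙ₊₁] n)

fibPeriod⇔alphaPeriod : ∀ m k → IsFibPeriod m k ⇔ IsAlphaPeriod m k
fibPeriod⇔alphaPeriod m k = mk⇔ fib⇒α α⇒fib
  where
  open ℤ[α]-mod m
  open import Relation.Binary.Reasoning.Setoid setoid

  fib⇒α : IsFibPeriod m k → IsAlphaPeriod m k
  fib⇒α Fₖ₊ₙ≡Fₙ = period-by-inverse {α} {α⁻¹} {k} ≈-refl (begin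
    α ^ suc k                       ≡⟨ ^≡^α α (suc k) ⟩
    α ^α suc k                      ≡⟨ α^[1+n]≡[Fₙ,Fₙ₊₁] k ⟩
    (+ fib k , + fib (suc k))       ≈⟨ ≡[mod]⇒≋ (Fₖ₊ₙ≡Fₙ 0) , ≡[mod]⇒≋ (Fₖ₊ₙ≡Fₙ 1) ⟩
    α                               ∎)

  α⇒fib : IsAlphaPeriod m k → IsFibPeriod m k
  α⇒fib αᵏ≈1 n =
    ≋⇒≡[mod] (≡.subst₂ (_≋_[mod m ]) (coeff₁ (n ℕ.+ k)) (coeff₁ n) (_≈α_[mod_].coeff₁ αⁿ⁺ᵏ≈αⁿ))
    where
    coeff₁ : ∀ j → proj₂ (α ^ j) ≡ + fib j
    coeff₁ j = ≡.trans (cong proj₂ (^≡^α α j)) (coeff₁-α^n≡Fₙ j)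
    αⁿ⁺ᵏ≈αⁿ : α ^ (n ℕ.+ k) ≈ α ^ n
    αⁿ⁺ᵏ≈αⁿ = begin
      α ^ (n ℕ.+ k)    ≈⟨ ^-homo-* α n k ⟩
      α ^ n * α ^ k    ≈⟨ *-congˡ {α ^ n} αᵏ≈1 ⟩
      α ^ n * 1#       ≈⟨ *-identityʳ (α ^ n) ⟩
      α ^ n            ∎

leastAlphaPeriod-∣ : ∀ m {K j} → IsLeastPositive (IsAlphaPeriod m) K → IsAlphaPeriod m j → K ∣ j
leastAlphaPeriod-∣ m = ℤ[α]-mod.leastPeriod-∣ m {α}

alphaPeriod-∣ : ∀ m {k j} → IsAlphaPeriod m k → k ∣ j → IsAlphaPeriod m j
alphaPeriod-∣ m = ℤ[α]-mod.period-∣ m {α}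

alphaPeriod? : ∀ m k → Dec (IsAlphaPeriod m k)
alphaPeriod? m k = α ^ k ≟ 1# where open ℤ[α]-mod m

-- The power α ^ k of ℤ[α]/ m is stuck on k together with the whole ring record, so it is not
-- definitionally independent of m; different moduli are compared through _^α_.
alphaPeriod⇔α^k≈1 : ∀ m k → IsAlphaPeriod m k ⇔ α ^α k ≈α oneα [mod m ]
alphaPeriod⇔α^k≈1 m k = mk⇔ (subst (_≈α oneα [mod m ]) (^≡^α α k))
                              (subst (_≈α oneα [mod m ]) (≡.sym (^≡^α α k)))
  where open ℤ[α]-mod m

alphaPeriod⇔α^k≡1 : ∀ m k → IsAlphaPeriod m k ⇔ (α ^α k) ≡α oneα [mod m ]
alphaPeriod⇔α^k≡1 m k = mk⇔
  (≈α⇒≡α {α ^α k} {oneα} ∘ Equivalence.to (alphaPeriod⇔α^k≈1 m k))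
  (Equivalence.from (alphaPeriod⇔α^k≈1 m k) ∘ ≡α⇒≈α {α ^α k} {oneα})

alphaPeriod-mod-*ʳ : ∀ m n k → IsAlphaPeriod (m ℕ.* n) k → IsAlphaPeriod m k
alphaPeriod-mod-*ʳ m n k αᵏ≈1 = Equivalence.from (alphaPeriod⇔α^k≈1 m k)
  (≈α-mod-*ʳ (Equivalence.to (alphaPeriod⇔α^k≈1 (m ℕ.* n) k) αᵏ≈1))

module _ (p : ℕ) where

  open ℤ[α]-mod (p ℕ.* p)

  private
    P : ℤ
    P = + p

    ≋-by-p² : ∀ {a b} q → a ℤ.- b ≡ q ℤ.* (P ℤ.* P) → a ≋ b [mod p ℕ.* p ]
    ≋-by-p² q eq = ≋-by eq (divides q (cong (q ℤ.*_) (≡.sym (ℤ.pos-* p p))))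

  1+npy : ℕ → ZAlpha → ZAlpha
  1+npy n (u , v) = (+ 1 ℤ.+ + n ℤ.* (u ℤ.* P) , + 0 ℤ.+ + n ℤ.* (v ℤ.* P))

  [1+py]^n≈1+npy : ∀ y n → 1+npy 1 y ^ n ≈ 1+npy n y
  [1+py]^n≈1+npy y zero = ≈-refl
  [1+py]^n≈1+npy y@(u , v) (suc n) = begin
    1+npy 1 y * 1+npy 1 y ^ n   ≈⟨ *-congˡ {1+npy 1 y} ([1+py]^n≈1+npy y n) ⟩
    1+npy 1 y * 1+npy n y       ≈⟨ ≋-by-p² (N ℤ.* (u ℤ.* u ℤ.+ v ℤ.* v)) (lemma₀ u v P N)
                                 , ≋-by-p² (N ℤ.* (+ 2 ℤ.* u ℤ.* v ℤ.+ v ℤ.* v)) (lemma₁ u v P N) ⟩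
    1+npy (suc n) y             ∎
    where
    open import Relation.Binary.Reasoning.Setoid setoid
    N = + n
    lemma₀ : ∀ u v P N →
      (+ 1 ℤ.+ + 1 ℤ.* (u ℤ.* P)) ℤ.* (+ 1 ℤ.+ N ℤ.* (u ℤ.* P))
        ℤ.+ (+ 0 ℤ.+ + 1 ℤ.* (v ℤ.* P)) ℤ.* (+ 0 ℤ.+ N ℤ.* (v ℤ.* P))
        ℤ.- (+ 1 ℤ.+ (+ 1 ℤ.+ N) ℤ.* (u ℤ.* P))
      ≡ N ℤ.* (u ℤ.* u ℤ.+ v ℤ.* v) ℤ.* (P ℤ.* P)
    lemma₀ = solve-∀
    lemma₁ : ∀ u v P N →
      (+ 1 ℤ.+ + 1 ℤ.* (u ℤ.* P)) ℤ.* (+ 0 ℤ.+ N ℤ.* (v ℤ.* P))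
        ℤ.+ (+ 0 ℤ.+ + 1 ℤ.* (v ℤ.* P)) ℤ.* (+ 1 ℤ.+ N ℤ.* (u ℤ.* P))
        ℤ.+ (+ 0 ℤ.+ + 1 ℤ.* (v ℤ.* P)) ℤ.* (+ 0 ℤ.+ N ℤ.* (v ℤ.* P))
        ℤ.- (+ 0 ℤ.+ (+ 1 ℤ.+ N) ℤ.* (v ℤ.* P))
      ≡ N ℤ.* (+ 2 ℤ.* u ℤ.* v ℤ.+ v ℤ.* v) ℤ.* (P ℤ.* P)
    lemma₁ = solve-∀

  ≈1[mod-p]⇒≡1+py : ∀ x → x ≈α oneα [mod p ] → ∃ λ y → x ≡ 1+npy 1 y
  ≈1[mod-p]⇒≡1+py (a , b) (mod-divides (divides u a-1≡uP) , mod-divides (divides v b-0≡vP)) =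
    (u , v) , cong₂ _,_ (shift {c = + 1} a-1≡uP) (shift {c = + 0} b-0≡vP)
    where
    shift : ∀ {a c d} → a ℤ.- c ≡ d → a ≡ c ℤ.+ + 1 ℤ.* d
    shift {a} {c} eq = ≡.trans (lemma a c) (cong (λ d → c ℤ.+ + 1 ℤ.* d) eq)
      where
      lemma : ∀ a c → a ≡ c ℤ.+ + 1 ℤ.* (a ℤ.- c)
      lemma = solve-∀

  ^p-lifts : ∀ x → x ≈α oneα [mod p ] → x ^ p ≈ 1#
  ^p-lifts x x≈1 with ≈1[mod-p]⇒≡1+py x x≈1
  ... | y@(u , v) , refl = begin
    1+npy 1 y ^ p    ≈⟨ [1+py]^n≈1+npy y p ⟩
    1+npy p y        ≈⟨ ≋-by-p² u (lemma₀ u P) , ≋-by-p² v (lemma₁ v P) ⟩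
    1#               ∎
    where
    open import Relation.Binary.Reasoning.Setoid setoid
    lemma₀ : ∀ u P → (+ 1 ℤ.+ P ℤ.* (u ℤ.* P)) ℤ.- + 1 ≡ u ℤ.* (P ℤ.* P)
    lemma₀ = solve-∀
    lemma₁ : ∀ v P → (+ 0 ℤ.+ P ℤ.* (v ℤ.* P)) ℤ.- + 0 ≡ v ℤ.* (P ℤ.* P)
    lemma₁ = solve-∀

alphaPeriod-lift : ∀ p k → IsAlphaPeriod p k → IsAlphaPeriod (p ℕ.* p) (k ℕ.* p)
alphaPeriod-lift p k αᵏ≈1 = begin
  α ^ (k ℕ.* p)    ≈⟨ ^-assocʳ α k p ⟨
  (α ^ k) ^ p      ≡⟨ cong (_^ p) (^≡^α α k) ⟩
  (α ^α k) ^ p     ≈⟨ ^p-lifts p (α ^α k) (Equivalence.to (alphaPeriod⇔α^k≈1 p k) αᵏ≈1) ⟩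
  1#               ∎
  where
  open ℤ[α]-mod (p ℕ.* p)
  open import Relation.Binary.Reasoning.Setoid setoid

-- α^(p²) modulo p

module _ {p} (p-prime : Prime p) where

  open ℤ[α]-mod p
  open Frobenius commutativeSemiring using (fermatsLittleTheorem; fermatsLittleTheorem²; ^p²-distrib-+)
  open import Relation.Binary.Reasoning.Setoid setoid

  ℤ[α]/p-characteristic : p · 1# ≈ 0#
  ℤ[α]/p-characteristic = trans (n·1#≈n p) (≋-by (ℤ.+-identityʳ (+ p)) ℤ∣.∣-refl , ≋-refl)

  ·1#-cancelˡ : ∀ {c} → ¬ p ∣ c → ∀ {x y} → (c · 1#) * x ≈ (c · 1#) * y → x ≈ y
  ·1#-cancelˡ {c} p∤c {a , b} {a′ , b′} cx≈cy =
    ≋-cancel-*ˡ p-prime p∤c (_≈α_[mod_].coeff₀ cx≈cy′) ,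
    ≋-cancel-*ˡ p-prime p∤c (_≈α_[mod_].coeff₁ cx≈cy′)
    where
    scale : ∀ x y → (+ c , + 0) *α (x , y) ≈ (+ c ℤ.* x , + c ℤ.* y)
    scale x y = ≈α-reflexive p (cong₂ _,_ (lemma₀ (+ c) x y) (lemma₁ (+ c) x y))
      where
      lemma₀ : ∀ c x y → c ℤ.* x ℤ.+ + 0 ℤ.* y ≡ c ℤ.* x
      lemma₀ = solve-∀
      lemma₁ : ∀ c x y → c ℤ.* y ℤ.+ + 0 ℤ.* x ℤ.+ + 0 ℤ.* y ≡ c ℤ.* y
      lemma₁ = solve-∀
    cx≈cy′ : (+ c ℤ.* a , + c ℤ.* b) ≈ (+ c ℤ.* a′ , + c ℤ.* b′)
    cx≈cy′ = begin
      (+ c ℤ.* a , + c ℤ.* b)       ≈⟨ scale a b ⟨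
      (+ c , + 0) *α (a , b)        ≈⟨ *-congʳ (n·1#≈n c) ⟨
      (c · 1#) * (a , b)            ≈⟨ cx≈cy ⟩
      (c · 1#) * (a′ , b′)          ≈⟨ *-congʳ (n·1#≈n c) ⟩
      (+ c , + 0) *α (a′ , b′)      ≈⟨ scale a′ b′ ⟩
      (+ c ℤ.* a′ , + c ℤ.* b′)     ∎

  module _ (p≢2 : p ≢ 2) (p≢5 : p ≢ 5) where

    private
      h : ℕ
      h = proj₁ (odd-prime p-prime p≢2)

      p≡1+2h : p ≡ suc (2 ℕ.* h)
      p≡1+2h = proj₂ (odd-prime p-prime p≢2)

      M : ℕ
      M = 2 ℕ.* h ℕ.* suc h

      p²≡1+2M : p ℕ.* p ≡ suc (2 ℕ.* M)
      p²≡1+2M = ≡.trans (cong₂ ℕ._*_ p≡1+2h p≡1+2h) (lemma h)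
        where
        lemma : ∀ h → suc (2 ℕ.* h) ℕ.* suc (2 ℕ.* h) ≡ suc (2 ℕ.* (2 ℕ.* h ℕ.* suc h))
        lemma = ℕ-Solver.solve-∀

      five : ZAlpha
      five = 5 · 1#

      √5 : ZAlpha
      √5 = (ℤ.- + 1 , + 2)

      √5²≈5 : √5 ^ 2 ≈ five
      √5²≈5 = trans (*-congˡ {√5} (*-identityʳ √5)) (sym (n·1#≈n 5))

      fermat : ∀ n → (n · 1#) ^ p ≈ n · 1#
      fermat = fermatsLittleTheorem p-prime ℤ[α]/p-characteristic

    five^[p-1]≈1 : five ^ (2 ℕ.* h) ≈ 1#
    five^[p-1]≈1 = ·1#-cancelˡ (prime∤prime p-prime (Dec.from-yes (prime? 5)) p≢5) (begin
      five * five ^ (2 ℕ.* h)   ≈⟨ ^-congʳ five p≡1+2h ⟨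
      five ^ p                  ≈⟨ fermat 5 ⟩
      five                      ≈⟨ *-identityʳ five ⟨
      five * 1#                 ∎)

    √5^p²≈√5 : √5 ^ (p ℕ.* p) ≈ √5
    √5^p²≈√5 = begin
      √5 ^ (p ℕ.* p)                     ≈⟨ ^-congʳ √5 p²≡1+2M ⟩
      √5 * √5 ^ (2 ℕ.* M)                ≈⟨ *-congˡ {√5} (^-assocʳ √5 2 M) ⟨
      √5 * (√5 ^ 2) ^ M                  ≈⟨ *-congˡ {√5} (^-congˡ M √5²≈5) ⟩
      √5 * five ^ M                      ≈⟨ *-congˡ {√5} (^-assocʳ five (2 ℕ.* h) (suc h)) ⟨
      √5 * (five ^ (2 ℕ.* h)) ^ suc h    ≈⟨ *-congˡ {√5} (^-congˡ (suc h) five^[p-1]≈1) ⟩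
      √5 * 1# ^ suc h                    ≈⟨ *-congˡ {√5} (1#^n≈1# (suc h)) ⟩
      √5 * 1#                            ≈⟨ *-identityʳ √5 ⟩
      √5                                 ∎

    α^p²≈α : α ^ (p ℕ.* p) ≈ α
    α^p²≈α = ·1#-cancelˡ (prime∤prime p-prime prime[2] p≢2) (begin
      two * α ^ p²               ≈⟨ *-congʳ (fermatsLittleTheorem² p-prime ℤ[α]/p-characteristic 2) ⟨
      two ^ p² * α ^ p²          ≈⟨ ^-distrib-* two α p² ⟨
      (two * α) ^ p²             ≡⟨⟩
      (1# + √5) ^ p²             ≈⟨ ^p²-distrib-+ p-prime ℤ[α]/p-characteristic 1# √5 ⟩
      1# ^ p² + √5 ^ p²          ≈⟨ +-cong (1#^n≈1# p²) √5^p²≈√5 ⟩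
      1# + √5                    ≡⟨⟩
      two * α                    ∎)
      where
      open import Algebra.Properties.CommutativeSemiring.Exp commutativeSemiring using (^-distrib-*)
      two = 2 · 1#
      p² = p ℕ.* p

    alphaPeriod-p²-1 : IsAlphaPeriod p (p ℕ.* p ∸ 1)
    alphaPeriod-p²-1 = period-by-inverse {α} {α⁻¹} {p ℕ.* p ∸ 1} ≈-refl (begin
      α ^ suc (p ℕ.* p ∸ 1)   ≡⟨ cong (λ n → α ^ suc (n ∸ 1)) p²≡1+2M ⟩
      α ^ suc (2 ℕ.* M)       ≡⟨ cong (α ^_) p²≡1+2M ⟨
      α ^ (p ℕ.* p)           ≈⟨ α^p²≈α ⟩
      α                       ∎)

-- π(p) versus π(p²)

pisanoPeriod⇔leastAlphaPeriod : ∀ m k → IsPisanoPeriod m k ⇔ IsLeastPositive (IsAlphaPeriod m) k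
pisanoPeriod⇔leastAlphaPeriod m = leastPositive-cong (fibPeriod⇔alphaPeriod m)

0<p²-1 : ∀ {p} → 1 < p → 0 < p ℕ.* p ∸ 1
0<p²-1 (s≤s (s≤s _)) = s≤s z≤n

∣Kp⇒∣p²-1⇒∣K : ∀ {k K} p → k ∣ K ℕ.* suc p → k ∣ suc p ℕ.* suc p ∸ 1 → k ∣ K
∣Kp⇒∣p²-1⇒∣K {k} {K} p k∣Kp k∣p²-1 =
  ℕ∣.∣m+n∣m⇒∣n (subst (k ∣_) (identity p K) (ℕ∣.∣n⇒∣m*n (suc p) k∣Kp))
               (ℕ∣.∣m⇒∣m*n K k∣p²-1)
  where
  identity : ∀ p K → suc p ℕ.* (K ℕ.* suc p) ≡ (p ℕ.+ p ℕ.* suc p) ℕ.* K ℕ.+ K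
  identity = ℕ-Solver.solve-∀

leastAlphaPeriod-p²≡p : ∀ {p k K} → 0 < p →
  IsLeastPositive (IsAlphaPeriod p) K → IsLeastPositive (IsAlphaPeriod (p ℕ.* p)) k →
  IsAlphaPeriod (p ℕ.* p) (p ℕ.* p ∸ 1) → k ≡ K
leastAlphaPeriod-p²≡p {suc q} {k} {K} _ least-p@(_ , αᴷ≈1 , _) least-p²@(_ , αᵏ≈1 , _) αᴺ≈1 =
  ℕ∣.∣-antisym (∣Kp⇒∣p²-1⇒∣K q k∣Kp k∣N) K∣k
  where
  p = suc q
  K∣k : K ∣ k
  K∣k = leastAlphaPeriod-∣ p least-p (alphaPeriod-mod-*ʳ p p k αᵏ≈1)
  k∣Kp : k ∣ K ℕ.* p
  k∣Kp = leastAlphaPeriod-∣ (p ℕ.* p) least-p² (alphaPeriod-lift p K αᴷ≈1)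
  k∣N : k ∣ p ℕ.* p ∸ 1
  k∣N = leastAlphaPeriod-∣ (p ℕ.* p) least-p² αᴺ≈1

alphaPeriod-transfer : ∀ {m n k} j → IsPisanoPeriod m k → IsPisanoPeriod n k →
  IsAlphaPeriod m j → IsAlphaPeriod n j
alphaPeriod-transfer {m} {n} j πₘ πₙ αʲ≈1 =
  alphaPeriod-∣ n {j = j} (proj₁ (proj₂ (Equivalence.to (pisanoPeriod⇔leastAlphaPeriod n _) πₙ)))
    (leastAlphaPeriod-∣ m (Equivalence.to (pisanoPeriod⇔leastAlphaPeriod m _) πₘ) αʲ≈1)

pisanoPeriod-p≡p² : ∀ p → 1 < p → IsAlphaPeriod (p ℕ.* p) (p ℕ.* p ∸ 1) →
  ∃ λ k → IsPisanoPeriod p k × IsPisanoPeriod (p ℕ.* p) k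
pisanoPeriod-p≡p² p p>1 αᴺ≈1
  with leastPositive-exists (alphaPeriod? p) (0<p²-1 p>1)
         (alphaPeriod-mod-*ʳ p p (p ℕ.* p ∸ 1) αᴺ≈1)
     | leastPositive-exists (alphaPeriod? (p ℕ.* p)) (0<p²-1 p>1) αᴺ≈1
... | K , least-p | k , least-p² =
  K , Equivalence.from (pisanoPeriod⇔leastAlphaPeriod p K) least-p
    , Equivalence.from (pisanoPeriod⇔leastAlphaPeriod (p ℕ.* p) K)
        (subst (IsLeastPositive (IsAlphaPeriod (p ℕ.* p))) k≡K least-p²)
  where
  k≡K : k ≡ K
  k≡K = leastAlphaPeriod-p²≡p (ℕ.<⇒≤ p>1) least-p least-p² αᴺ≈1

-- Imported only here because the semiring modules above open their own _*_.
open import Data.Nat using (_*_)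

mainTheorem4 : (p : ℕ) → Prime p → p ≢ 2 → p ≢ 5 →
    (∃ λ k → IsPisanoPeriod p k × IsPisanoPeriod (p * p) k)
      ⇔ ((α ^α (p * p ∸ 1)) ≡α oneα [mod (p * p) ])
mainTheorem4 p p-prime p≢2 p≢5 = mk⇔
  (λ (_ , πₚ , πₚ²) → Equivalence.to α^N≡1⇔
     (alphaPeriod-transfer (p * p ∸ 1) πₚ πₚ² (alphaPeriod-p²-1 p-prime p≢2 p≢5)))
  (λ α^N≡1 → pisanoPeriod-p≡p² p (ℕ.nonTrivial⇒n>1 p {{prime⇒nonTrivial p-prime}})
     (Equivalence.from α^N≡1⇔ α^N≡1))
  where
  α^N≡1⇔ : IsAlphaPeriod (p * p) (p * p ∸ 1) ⇔ (α ^α (p * p ∸ 1)) ≡α oneα [mod p * p ]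
  α^N≡1⇔ = alphaPeriod⇔α^k≡1 (p * p) (p * p ∸ 1)
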